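{- Let $H$ be a $(1,k)$-graph on $[t]\cup V'$ with $|V'|=t$, and let $W$ be a sequentially walk in $H$ which starts with the $(1,k)$-tuple $X$ and ends with the $(1,k)$-tuple $Y$. Then there exists a sequentially walk $W'$ in $H$ of length at most $kt^{k+1}$ which starts with $X$ and ends with $Y$, and $\ell(W')\equiv\ell(W)\pmod k$.
   Context: A $(1,k)$-graph on $[t]\cup V'$ has colors $[t]$ and points $V'$, every edge containing exactly one color and $k$ points. A sequentially walk is a sequence of points $(v_1,\dots,v_\ell)$ together with a sequence of colors $(c_1,\dots,c_{\ell-k+1})$ such that $\{c_j,v_j,\dots,v_{j+k-1}\}$ is an edge for every $j$ (points, colors and edges may repeat); its length $\ell(W)$ is its number of points $\ell$. It starts with the $(1,k)$-tuple $(c_1,v_1,\dots,v_k)$ and ends with $(c_{\ell-k+1},v_{\ell-k+1},\dots,v_\ell)$. -}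

module Defs where

open import Data.Nat using (ℕ; zero; suc; _+_; _*_; _^_; _≤_; NonZero)
open import Data.Nat.DivMod using (_%_)
open import Data.Fin using (Fin; toℕ)
open import Data.Fin.Subset using (Subset; ⁅_⁆; _∪_; ∣_∣; ⊥)
open import Data.List using (List; foldr; map; upTo)
open import Data.Vec using (Vec; lookup)
open import Data.Product using (_×_; _,_)
open import Relation.Binary.PropositionalEquality using (_≡_)

-- A (1,k)-graph with colour set [t] (= Fin t) and point set V' (= Fin t,
-- since |V'| = t).  An edge {c} ∪ S consists of one colour c and a set S of
-- exactly k points.
record OneKGraph (t k : ℕ) : Set₁ where
  field
    Edge      : Fin t → Subset t → Set
    edge-size : ∀ c S → Edge c S → ∣ S ∣ ≡ k
open OneKGraph public

Tuple : (t k : ℕ) → Set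
Tuple t k = Fin t × Vec (Fin t) k

window : ∀ {t} (k : ℕ) → (ℕ → Fin t) → ℕ → Subset t
window k v j = foldr (λ i S → ⁅ v (j + i) ⁆ ∪ S) ⊥ (upTo k)

-- A sequentially walk with m+1 colours c 0 … c m and m+k points v 0 … v (m+k-1).
-- (Values of pts/cols beyond these ranges are irrelevant.)
record Walk {t k : ℕ} (H : OneKGraph t k) : Set where
  field
    m    : ℕ
    pts  : ℕ → Fin t
    cols : ℕ → Fin t
    isWalk : ∀ j → j ≤ m → Edge H (cols j) (window k pts j)
open Walk public

-- length = number of points
len : ∀ {t k} {H : OneKGraph t k} → Walk H → ℕ
len {k = k} W = m W + k

StartsWith : ∀ {t k} {H : OneKGraph t k} → Walk H → Tuple t k → Set
StartsWith {k = k} W (c , xs) =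
  (cols W 0 ≡ c) × (∀ (i : Fin k) → pts W (Data.Fin.toℕ i) ≡ lookup xs i)

EndsWith : ∀ {t k} {H : OneKGraph t k} → Walk H → Tuple t k → Set
EndsWith {k = k} W (c , ys) =
  (cols W (m W) ≡ c) × (∀ (i : Fin k) → pts W (m W + Data.Fin.toℕ i) ≡ lookup ys i)

-- Record at each position y of a walk its state: y mod k together with the k
-- points starting at y; there are only k t^k states.  If the walk has more than
-- k t^k positions after the first, two of them, i < j, have the same state.
-- Deleting the points and colours with indices i, …, j-1 leaves a walk: every
-- surviving edge keeps its colour and sees the same k points as before, because
-- the points from i on and from j on agree for k steps.  The first and last
-- (1,k)-tuples are unchanged, and as k divides j - i the length keeps its
-- residue mod k.  Iterating yields a walk with at most k t^k + k points, which is
-- at most k t^(k+1) when t ≥ 2.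
module Submission where

open import Defs
open import Data.Nat using (ℕ; _+_; _*_; _^_; _≤_; NonZero)
open import Data.Nat.DivMod using (_%_)
open import Data.Product using (Σ; _×_)
open import Relation.Binary.PropositionalEquality using (_≡_)

open import Algebra.Properties.CommutativeSemigroup using (xy∙z≈xz∙y; x∙yz≈y∙xz)
open import Data.Fin using (Fin; toℕ; combine) renaming (zero to fzero)
open import Data.Fin.Properties using (pigeonhole; combine-injective; toℕ<n; toℕ-fromℕ<)
open import Data.Fin.Subset using (⁅_⁆; _∪_)
open import Data.Fin.Subset.Properties using (∣p∣≤n)
open import Data.List using (List; []; _∷_; foldr)
open import Data.List.Membership.Propositional using (_∈_)
open import Data.List.Membership.Propositional.Properties using (∈-upTo⁻)
open import Data.List.Relation.Unary.Any using (here; there)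
open import Data.Nat using (zero; suc; _∸_; _<_; _<?_; z≤n; s≤s; s<s; >-nonZero; >-nonZero⁻¹)
open import Data.Nat.Divisibility using (_∣_; divides; ∣m+n∣m⇒∣n; n∣m*n)
open import Data.Nat.DivMod using (_/_; _mod_; m≡m%n+[m/n]*n; %-remove-+ʳ; [m+n]%n≡m%n; n%1≡0)
open import Data.Nat.Induction using (<-wellFounded)
open import Data.Nat.Properties
open import Data.Sum using (inj₁; inj₂)
open import Data.Product using (_,_; proj₁; proj₂; ∃₂)
open import Function using (_∘_)
open import Induction.WellFounded using (Acc; acc)
open import Relation.Nullary using (yes; no; contradiction)
open import Relation.Binary.PropositionalEquality
  using (refl; sym; trans; cong; subst; subst₂; module ≡-Reasoning)

+-rightComm : ∀ m n o → m + n + o ≡ m + o + n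
+-rightComm = xy∙z≈xz∙y +-commutativeSemigroup

foldr-cong-∈ : ∀ {A B : Set} {f g : A → B → B} (e : B) (xs : List A)
  → (∀ {x} → x ∈ xs → ∀ b → f x b ≡ g x b) → foldr f e xs ≡ foldr g e xs
foldr-cong-∈ e []       f≗g = refl
foldr-cong-∈ {f = f} e (x ∷ xs) f≗g =
  trans (cong (f x) (foldr-cong-∈ e xs (f≗g ∘ there))) (f≗g (here refl) _)

[m+d]%n≡m%n⇒n∣d : ∀ m d {n} .{{_ : NonZero n}} → (m + d) % n ≡ m % n → n ∣ d
[m+d]%n≡m%n⇒n∣d m d {n} eq =
  ∣m+n∣m⇒∣n (divides ((m + d) / n) (+-cancelˡ-≡ (m % n) _ _ decomposition)) (n∣m*n (m / n))
  where
  open ≡-Reasoning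
  decomposition : m % n + (m / n * n + d) ≡ m % n + (m + d) / n * n
  decomposition = begin
    m % n + (m / n * n + d)          ≡⟨ +-assoc (m % n) _ d ⟨
    m % n + m / n * n + d            ≡⟨ cong (_+ d) (m≡m%n+[m/n]*n m n) ⟨
    m + d                            ≡⟨ m≡m%n+[m/n]*n (m + d) n ⟩
    (m + d) % n + (m + d) / n * n    ≡⟨ cong (_+ (m + d) / n * n) eq ⟩
    m % n + (m + d) / n * n          ∎

mod≡⇒%≡ : ∀ {m o} n .{{_ : NonZero n}} → m mod n ≡ o mod n → m % n ≡ o % n
mod≡⇒%≡ n eq = trans (sym (toℕ-fromℕ< _)) (trans (cong toℕ eq) (toℕ-fromℕ< _))

repetition : ∀ {n} m (f : ℕ → Fin n) → n < m
  → ∃₂ λ i d → 0 < i × 0 < d × i + d ≤ m × f i ≡ f (i + d)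
repetition m f n<m with a , b , a<b , fa≡fb ← pigeonhole n<m (f ∘ suc ∘ toℕ)
                   with e , a+e≡b ← m≤n⇒∃[o]m+o≡n a<b =
  suc (toℕ a) , suc e , s≤s z≤n , s≤s z≤n ,
  subst (_≤ m) (sym i+d≡) (toℕ<n b) , trans fa≡fb (cong f (sym i+d≡))
  where
  i+d≡ : suc (toℕ a) + suc e ≡ suc (toℕ b)
  i+d≡ = trans (+-suc (suc (toℕ a)) e) (cong suc a+e≡b)

encode : ∀ {t} k → (ℕ → Fin t) → Fin (t ^ k)
encode zero    v = fzero
encode (suc k) v = combine (v 0) (encode k (v ∘ suc))

encode-injective : ∀ {t} k (v w : ℕ → Fin t) → encode k v ≡ encode k w
  → ∀ s → s < k → v s ≡ w s
encode-injective (suc k) v w eq zero    _         = proj₁ (combine-injective (v 0) _ (w 0) _ eq)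
encode-injective (suc k) v w eq (suc s) (s<s s<k) =
  encode-injective k (v ∘ suc) (w ∘ suc) (proj₂ (combine-injective (v 0) _ (w 0) _ eq)) s s<k

excise : ∀ {A : Set} → ℕ → ℕ → (ℕ → A) → ℕ → A
excise i d f x with x <? i
... | yes _ = f x
... | no  _ = f (x + d)

excise-< : ∀ {A : Set} {i d x} (f : ℕ → A) → x < i → excise i d f x ≡ f x
excise-< {i = i} {x = x} f x<i with x <? i
... | yes _   = refl
... | no  x≮i = contradiction x<i x≮i

excise-≥ : ∀ {A : Set} {i d x} (f : ℕ → A) → i ≤ x → excise i d f x ≡ f (x + d)
excise-≥ {i = i} {x = x} f i≤x with x <? i
... | yes x<i = contradiction i≤x (<⇒≱ x<i)
... | no  _   = refl

window-cong : ∀ {t} k (v w : ℕ → Fin t) (j j′ : ℕ)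
  → (∀ r → r < k → v (j + r) ≡ w (j′ + r)) → window k v j ≡ window k w j′
window-cong k v w j j′ eq =
  foldr-cong-∈ _ _ λ r∈ S → cong (λ p → ⁅ p ⁆ ∪ S) (eq _ (∈-upTo⁻ r∈))

edge-size-≤ : ∀ {t k} (H : OneKGraph t k) {c S} → Edge H c S → k ≤ t
edge-size-≤ H {c} {S} e = subst (_≤ _) (edge-size H c S e) (∣p∣≤n S)

module Excision {t k} {H : OneKGraph t k} (W : Walk H) (i d : ℕ)
  (i+d≤m : i + d ≤ m W) (repeats : ∀ s → s < k → pts W (i + s) ≡ pts W (i + d + s)) where

  m′ : ℕ
  m′ = m W ∸ d

  m′+d≡m : m′ + d ≡ m W
  m′+d≡m = m∸n+n≡m (m+n≤o⇒n≤o i i+d≤m)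

  i≤m′ : i ≤ m′
  i≤m′ = m+n≤o⇒m≤o∸n i i+d≤m

  pts-below : ∀ x → x < i + k → excise i d (pts W) x ≡ pts W x
  pts-below x x<i+k with <-≤-connex x i
  ... | inj₁ x<i = excise-< (pts W) x<i
  ... | inj₂ i≤x with s , refl ← m≤n⇒∃[o]m+o≡n i≤x =
    trans (excise-≥ (pts W) i≤x)
          (trans (cong (pts W) (+-rightComm i s d)) (sym (repeats s (+-cancelˡ-< i s k x<i+k))))

  excised-isWalk : ∀ j → j ≤ m′ → Edge H (excise i d (cols W) j) (window k (excise i d (pts W)) j)
  excised-isWalk j j≤m′ with <-≤-connex j i
  ... | inj₁ j<i = subst₂ (Edge H) (sym (excise-< (cols W) j<i))
    (window-cong k (pts W) (excise i d (pts W)) j j λ r r<k → sym (pts-below (j + r) (+-mono-< j<i r<k)))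
    (isWalk W j (≤-trans (<⇒≤ j<i) (m+n≤o⇒m≤o i i+d≤m)))
  ... | inj₂ i≤j = subst₂ (Edge H) (sym (excise-≥ (cols W) i≤j))
    (window-cong k (pts W) (excise i d (pts W)) (j + d) j λ r _ →
      sym (trans (excise-≥ (pts W) (≤-trans i≤j (m≤m+n j r))) (cong (pts W) (+-rightComm j r d))))
    (isWalk W (j + d) (subst (j + d ≤_) m′+d≡m (+-monoˡ-≤ d j≤m′)))

  excised : Walk H
  excised = record
    { m = m′ ; pts = excise i d (pts W) ; cols = excise i d (cols W) ; isWalk = excised-isWalk }

  excised-starts : 0 < i → ∀ X → StartsWith W X → StartsWith excised X
  excised-starts 0<i _ (c≡ , xs≡) =
    trans (excise-< (cols W) 0<i) c≡ ,
    λ r → trans (pts-below (toℕ r) (<-≤-trans (toℕ<n r) (m≤n+m k i))) (xs≡ r)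

  excised-ends : ∀ Y → EndsWith W Y → EndsWith excised Y
  excised-ends _ (c≡ , ys≡) =
    trans (excise-≥ (cols W) i≤m′) (trans (cong (cols W) m′+d≡m) c≡) ,
    λ r → trans (excise-≥ (pts W) (≤-trans i≤m′ (m≤m+n m′ (toℕ r))))
                (trans (cong (pts W) (trans (+-rightComm m′ (toℕ r) d) (cong (_+ toℕ r) m′+d≡m))) (ys≡ r))

module _ {t k} .{{_ : NonZero k}} {H : OneKGraph t k} where

  record Shortcut (W : Walk H) : Set where
    field
      walk       : Walk H
      starts     : ∀ X → StartsWith W X → StartsWith walk X
      ends       : ∀ Y → EndsWith W Y → EndsWith walk Y
      m-residue  : m walk % k ≡ m W % k
  open Shortcut

  shortcut-refl : (W : Walk H) → Shortcut W
  shortcut-refl W = record { walk = W ; starts = λ _ s → s ; ends = λ _ e → e ; m-residue = refl }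

  shortcut-trans : ∀ {W} (S : Shortcut W) → Shortcut (walk S) → Shortcut W
  shortcut-trans S S′ = record
    { walk = walk S′
    ; starts = λ X → starts S′ X ∘ starts S X
    ; ends = λ Y → ends S′ Y ∘ ends S Y
    ; m-residue = trans (m-residue S′) (m-residue S) }

  state : Walk H → ℕ → Fin (k * t ^ k)
  state W y = combine (y mod k) (encode k (pts W ∘ (y +_)))

  shortcut-step : (W : Walk H) → k * t ^ k < m W → Σ (Shortcut W) λ S → m (walk S) < m W
  shortcut-step W kt^k<m with i , d , 0<i , 0<d , i+d≤m , state≡ ← repetition (m W) (state W) kt^k<m =
    record { walk = excised ; starts = excised-starts 0<i ; ends = excised-ends ; m-residue = residue } ,
    subst (m′ <_) m′+d≡m (m<m+n m′ 0<d)
    where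
    same-state = combine-injective _ _ _ _ state≡
    open Excision W i d i+d≤m (encode-injective k _ _ (proj₂ same-state))
    residue : m′ % k ≡ m W % k
    residue = trans (sym (%-remove-+ʳ m′ ([m+d]%n≡m%n⇒n∣d i d (sym (mod≡⇒%≡ k (proj₁ same-state))))))
                    (cong (_% k) m′+d≡m)

  bounded-shortcut : (W : Walk H) → Σ (Shortcut W) λ S → m (walk S) ≤ k * t ^ k
  bounded-shortcut W = go W (<-wellFounded (m W))
    where
    go : (W : Walk H) → Acc _<_ (m W) → Σ (Shortcut W) λ S → m (walk S) ≤ k * t ^ k
    go W (acc rec) with m W ≤? k * t ^ k
    ... | yes short = shortcut-refl W , short
    ... | no  long  with S , shorter ← shortcut-step W (≰⇒> long)
                    with S′ , bound ← go (walk S) (rec shorter) = shortcut-trans S S′ , bound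

m≤k*t^k⇒m+k≤k*t^[k+1] : ∀ {t} k m → 2 ≤ t → m ≤ k * t ^ k → m + k ≤ k * t ^ (k + 1)
m≤k*t^k⇒m+k≤k*t^[k+1] {t} k m 2≤t m≤ = begin
  m + k                 ≤⟨ +-mono-≤ m≤ (m≤m*n k (t ^ k) {{m^n≢0 t k}}) ⟩
  k * t ^ k + k * t ^ k ≡⟨ cong (k * t ^ k +_) (+-identityʳ (k * t ^ k)) ⟨
  2 * (k * t ^ k)       ≤⟨ *-monoˡ-≤ (k * t ^ k) 2≤t ⟩
  t * (k * t ^ k)       ≡⟨ x∙yz≈y∙xz *-commutativeSemigroup t k (t ^ k) ⟩
  k * t ^ suc k         ≡⟨ cong (λ e → k * t ^ e) (+-comm 1 k) ⟩
  k * t ^ (k + 1)       ∎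
  where
  open ≤-Reasoning
  instance
    t≢0 : NonZero t
    t≢0 = >-nonZero (≤-trans (s≤s z≤n) 2≤t)

first-edge : ∀ {t k} {H : OneKGraph t k} → Walk H → Walk H
first-edge W = record
  { m = 0 ; pts = pts W ; cols = cols W ; isWalk = λ j j≤0 → isWalk W j (≤-trans j≤0 z≤n) }

Fin1-irrelevant : (a b : Fin 1) → a ≡ b
Fin1-irrelevant fzero fzero = refl

proposition6p5 : (t k : ℕ) → .{{_ : NonZero k}} → (H : OneKGraph t k)
    → (X Y : Tuple t k) → (W : Walk H) → StartsWith W X → EndsWith W Y
    → Σ (Walk H) (λ W' → StartsWith W' X × EndsWith W' Y
    × len W' ≤ k * t ^ (k + 1) × len W' % k ≡ len W % k)
proposition6p5 0 k H X Y W sx ey with () ← cols W 0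
-- Here k t^k + k exceeds k t^(k+1); but k ≤ t forces k = 1, and one edge suffices.
proposition6p5 1 k H X Y W sx ey with refl ← ≤-antisym (edge-size-≤ H (isWalk W 0 z≤n)) (>-nonZero⁻¹ k) =
  first-edge W , sx , (Fin1-irrelevant _ _ , λ r → Fin1-irrelevant _ _) , ≤-refl ,
  trans (n%1≡0 1) (sym (n%1≡0 (m W + 1)))
proposition6p5 t@(suc (suc _)) k H X Y W sx ey with S , m≤ ← bounded-shortcut W =
  walk S , starts S X sx , ends S Y ey , m≤k*t^k⇒m+k≤k*t^[k+1] k (m (walk S)) (s≤s (s≤s z≤n)) m≤ ,
  trans ([m+n]%n≡m%n (m (walk S)) k) (trans (m-residue S) (sym ([m+n]%n≡m%n (m W) k)))
  where open Shortcut
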